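{- Let $G=(V,E)$ be a 2-sparse graph of maximum degree $\Delta\geq 4$, and let $S$ be a stable set of $G$ containing every vertex of degree at least 3. Suppose each vertex of $S$ is precoloured with a colour from $\{1,\dots,\Delta+1\}$. Suppose that to every edge $uv$ with one end in $S$ a list $L_{uv}\subseteq\{1,\dots,\Delta+1\}$ is associated, such that for every $u\in S$ all edges incident to $u$ have the same list, and such that for every edge $uv$ with $u\in S$ we have $|L_{uv}|\geq \max\{\deg_G(u),\deg_G(v)\}$ and the precolour of $u$ does not belong to $L_{uv}$. Then there is a total-colouring $\pi$ of $G$ with colours in $\{1,\dots,\Delta+1\}$ that extends the precolouring of the vertices of $S$ and satisfies $\pi(uv)\in L_{uv}$ for every edge $uv$ with one end in $S$.
   Context: Graphs are finite and simple. A graph is 2-sparse if every edge is incident to at least one vertex of degree at most 2. A stable set is a set of pairwise non-adjacent vertices. An element of $G$ is a vertex or an edge; two elements are adjacent if they are adjacent vertices, edges sharing an endpoint, or a vertex and an edge incident to it. A total-colouring assigns colours to all elements so that adjacent elements receive distinct colours. -}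

module Defs where

open import Data.Nat using (ℕ; suc; _≤_; _⊔_)
open import Data.Bool using (Bool; true; false)
open import Data.Fin using (Fin)
open import Data.Fin.Subset using (Subset; _∈_; _∉_; ∣_∣)
open import Data.Vec using (tabulate)
open import Data.Sum using (_⊎_)
open import Data.Product using (Σ; ∃; _×_)
open import Relation.Binary.PropositionalEquality using (_≡_; _≢_)

record Graph (n : ℕ) : Set where
  field
    adj     : Fin n → Fin n → Bool
    sym     : ∀ u v → adj u v ≡ adj v u
    irrefl  : ∀ v → adj v v ≡ false

open Graph public

Adj : ∀ {n} → Graph n → Fin n → Fin n → Set
Adj G u v = adj G u v ≡ true

N : ∀ {n} → Graph n → Fin n → Subset n
N G v = tabulate (adj G v)

deg : ∀ {n} → Graph n → Fin n → ℕ
deg G v = ∣ N G v ∣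

MaxDegree : ∀ {n} → Graph n → ℕ → Set
MaxDegree {n} G Δ = (∀ v → deg G v ≤ Δ) × ∃ λ (v : Fin n) → deg G v ≡ Δ

TwoSparse : ∀ {n} → Graph n → Set
TwoSparse G = ∀ u v → Adj G u v → deg G u ≤ 2 ⊎ deg G v ≤ 2

Stable : ∀ {n} → Graph n → Subset n → Set
Stable G S = ∀ u v → u ∈ S → v ∈ S → adj G u v ≡ false

record TotalColouring {n} (G : Graph n) (C : Set) : Set where
  field
    vc      : Fin n → C
    ec      : Fin n → Fin n → C
    ec-sym  : ∀ u v → Adj G u v → ec u v ≡ ec v u
    vv      : ∀ u v → Adj G u v → vc u ≢ vc v
    ve      : ∀ u v → Adj G u v → vc u ≢ ec u v
    ee      : ∀ u v w → Adj G u v → Adj G u w → v ≢ w → ec u v ≢ ec u w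

open TotalColouring public

-- S is stable and contains every vertex of degree at least 3, so every edge has an end of degree at most 2
-- outside S, and the colouring is built in two rounds.
--
-- First the edges meeting S get colours from their lists.  Such an edge ux, u ∈ S, is seen as a half-edge owned
-- by u; two half-edges are mates when they are the S-ends of a path u x w with x ∉ S, and must then differ.
-- Every owner has at least as many colours as half-edges, and at least two when it owns a mated half-edge.  By
-- induction on the number of half-edges: if both ends of a mated pair have a spare colour, colour them with
-- distinct colours and delete those from the lists; otherwise an end has exactly two colours and two mated
-- half-edges, and it is contracted by linking its two mates directly.
--
-- Then the vertices outside S and the edges between them are coloured greedily: each of them is adjacent to at
-- most four elements, and Δ + 1 ≥ 5 colours are available.

module Submission where

open import Defs hiding (sym; irrefl)

open import Data.Bool using (true)
open import Data.Bool.Instances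
open import Data.Fin using (Fin; zero; suc)
open import Data.Fin.Instances
open import Data.Fin.Properties using (any?; ≤-total; ¬∀⟶∃¬; injective⇒≤)
  renaming (_≤?_ to _≤ᶠ?_; ≤-antisym to ≤ᶠ-antisym)
open import Data.Fin.Subset using (Subset; _∈_; _∉_; ∣_∣; _-_; ⁅_⁆; ⊥; inside; outside; Nonempty)
open import Data.Fin.Subset.Properties
  using (_∈?_; nonempty?; Empty-unique; ∉⊥; ∣⊥∣≡0; p⊆q⇒∣p∣≤∣q∣; p─⊥≡p; p─q⊆p; x∈p⇒∣p-x∣<∣p∣; x∈p∧x≢y⇒x∈p-y)
open import Data.List using (List; []; _∷_; _++_; length; map; filter; allFin; cartesianProduct)
open import Data.List.Membership.Propositional using () renaming (_∈_ to _∈ₗ_; _∉_ to _∉ₗ_)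
open import Data.List.Membership.Propositional.Properties
  using (∈-map⁺; ∈-++⁺ˡ; ∈-++⁺ʳ; ∈-allFin; ∈-cartesianProduct⁺; ∈-filter⁺; ∈-filter⁻)
open import Data.List.Properties using (length-map)
open import Data.List.Relation.Unary.Any using (here; there; index)
open import Data.List.Relation.Unary.Any.Properties using (lookup-index)
open import Data.Maybe using (Maybe; just; nothing)
open import Data.Maybe.Properties using (just-injective)
open import Data.Nat using (ℕ; zero; suc; _+_; _⊔_; _≤_; _<_; z≤n; s≤s)
open import Data.Nat.Induction using (<-wellFounded)
open import Data.Nat.Properties
  using (_≤?_; ≤-reflexive; ≤-trans; ≤-pred; n≤1+n; ≤-<-trans; <-trans; ≰⇒>; >⇒≢; <⇒≱; m≤m⊔n; m≤n⊔m;
         +-mono-≤; +-mono-<-≤; +-mono-≤-<; module ≤-Reasoning)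
open import Data.Product using (Σ; ∃; _×_; _,_; proj₁; proj₂)
open import Data.Product.Instances
open import Data.Sum using (_⊎_; inj₁; inj₂; [_,_])
open import Data.Sum.Instances
open import Data.Vec using (_∷_)
open import Data.Vec.Base using () renaming (there to thereᵥ)
open import Data.Vec.Properties using ([]=⇒lookup; lookup⇒[]=; lookup∘tabulate)
open import Function using (id; _∘_; _on_; case_of_)
open import Induction.WellFounded using (Acc; acc)
open import Relation.Binary.Construct.On using () renaming (wellFounded to on-wellFounded)
open import Relation.Binary.PropositionalEquality using (_≡_; _≢_; refl; sym; trans; cong; subst; subst₂)
open import Relation.Binary.Structures using (IsDecEquivalence)
open import Relation.Binary.TypeClasses using (_≟_)
open import Relation.Nullary using (¬_; Dec; yes; no; ¬?; contradiction)
open import Relation.Nullary.Decidable using (_×-dec_; decidable-stable)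

module _ {A B : Set} {{_ : IsDecEquivalence {A = A} _≡_}} where

  _[_↦_] : (A → B) → A → B → A → B
  (f [ a ↦ b ]) x with x ≟ a
  ... | yes _ = b
  ... | no _ = f x

  [↦]-updates : ∀ (f : A → B) a b → (f [ a ↦ b ]) a ≡ b
  [↦]-updates f a b with a ≟ a
  ... | yes _ = refl
  ... | no a≢a = contradiction refl a≢a

  [↦]-minimal : ∀ (f : A → B) {a} b {x} → x ≢ a → (f [ a ↦ b ]) x ≡ f x
  [↦]-minimal f {a} b {x} x≢a with x ≟ a
  ... | yes x≡a = contradiction x≡a x≢a
  ... | no _ = refl

  [↦]-elim : ∀ (P : B → Set) (f : A → B) a b {x} → (x ≡ a → P b) → (x ≢ a → P (f x)) → P ((f [ a ↦ b ]) x)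
  [↦]-elim P f a b {x} at away with x ≟ a
  ... | yes x≡a = at x≡a
  ... | no x≢a = away x≢a

just-unique : ∀ {A : Set} {m : Maybe A} {a b} → m ≡ just a → m ≡ just b → a ≡ b
just-unique refl refl = refl

x∉p-x : ∀ {n} (p : Subset n) x → x ∉ p - x
x∉p-x (s ∷ p) zero ()
x∉p-x (s ∷ p) (suc x) (thereᵥ x∈p-x) = x∉p-x p x x∈p-x

x∈p-y⇒x≢y : ∀ {n} {p : Subset n} {x y} → x ∈ p - y → x ≢ y
x∈p-y⇒x≢y {p = p} {y = y} x∈p-y refl = x∉p-x p y x∈p-y

∣p∣≤1+∣p-x∣ : ∀ {n} (p : Subset n) x → ∣ p ∣ ≤ suc ∣ p - x ∣
∣p∣≤1+∣p-x∣ (inside ∷ p) zero = ≤-reflexive (cong (suc ∘ ∣_∣) (sym (p─⊥≡p p)))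
∣p∣≤1+∣p-x∣ (outside ∷ p) zero = ≤-trans (n≤1+n ∣ p ∣) (≤-reflexive (cong (suc ∘ ∣_∣) (sym (p─⊥≡p p))))
∣p∣≤1+∣p-x∣ (inside ∷ p) (suc x) = s≤s (∣p∣≤1+∣p-x∣ p x)
∣p∣≤1+∣p-x∣ (outside ∷ p) (suc x) = ∣p∣≤1+∣p-x∣ p x

x∈p⇒0<∣p∣ : ∀ {n} {p : Subset n} {x} → x ∈ p → 0 < ∣ p ∣
x∈p⇒0<∣p∣ x∈p = ≤-<-trans z≤n (x∈p⇒∣p-x∣<∣p∣ x∈p)

two-elements : ∀ {n} {p : Subset n} {x y} → x ∈ p → y ∈ p → x ≢ y → 2 ≤ ∣ p ∣
two-elements x∈p y∈p x≢y =
  ≤-trans (s≤s (x∈p⇒0<∣p∣ (x∈p∧x≢y⇒x∈p-y y∈p (x≢y ∘ sym)))) (x∈p⇒∣p-x∣<∣p∣ x∈p)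

three-elements : ∀ {n} {p : Subset n} {x y z} → x ∈ p → y ∈ p → z ∈ p → x ≢ y → x ≢ z → y ≢ z → 3 ≤ ∣ p ∣
three-elements x∈p y∈p z∈p x≢y x≢z y≢z =
  ≤-trans (s≤s (two-elements (x∈p∧x≢y⇒x∈p-y y∈p (x≢y ∘ sym)) (x∈p∧x≢y⇒x∈p-y z∈p (x≢z ∘ sym)) y≢z))
          (x∈p⇒∣p-x∣<∣p∣ x∈p)

∣p∣≤2⇒pair : ∀ {n} {p : Subset n} {x} → ∣ p ∣ ≤ 2 → x ∈ p → ∃ λ y → ∀ {z} → z ∈ p → z ≡ x ⊎ z ≡ y
∣p∣≤2⇒pair {p = p} {x} ∣p∣≤2 x∈p with any? (λ y → (y ∈? p) ×-dec ¬? (y ≟ x))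
... | yes (y , y∈p , y≢x) = y , covers
  where
  covers : ∀ {z} → z ∈ p → z ≡ x ⊎ z ≡ y
  covers {z} z∈p with z ≟ x | z ≟ y
  ... | yes z≡x | _ = inj₁ z≡x
  ... | no _ | yes z≡y = inj₂ z≡y
  ... | no z≢x | no z≢y = contradiction (≤-trans (three-elements x∈p y∈p z∈p (y≢x ∘ sym) (z≢x ∘ sym) (z≢y ∘ sym)) ∣p∣≤2) λ { (s≤s (s≤s ())) }
... | no none = x , covers
  where
  covers : ∀ {z} → z ∈ p → z ≡ x ⊎ z ≡ x
  covers {z} z∈p with z ≟ x
  ... | yes z≡x = inj₁ z≡x
  ... | no z≢x = contradiction (z , z∈p , z≢x) none

0<∣p∣⇒nonempty : ∀ {n} {p : Subset n} → 0 < ∣ p ∣ → Nonempty p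
0<∣p∣⇒nonempty {n} {p} 0<∣p∣ with nonempty? p
... | yes ne = ne
... | no empty = contradiction (trans (cong ∣_∣ (Empty-unique empty)) (∣⊥∣≡0 n)) (>⇒≢ 0<∣p∣)

2≤∣p∣⇒∃≢ : ∀ {n} {p : Subset n} → 2 ≤ ∣ p ∣ → ∀ d → ∃ λ b → b ∈ p × b ≢ d
2≤∣p∣⇒∃≢ {p = p} 2≤∣p∣ d with 0<∣p∣⇒nonempty (≤-pred (≤-trans 2≤∣p∣ (∣p∣≤1+∣p-x∣ p d)))
... | b , b∈p-d = b , p─q⊆p p ⁅ d ⁆ b∈p-d , x∈p-y⇒x≢y b∈p-d

total : ∀ {n} → (Fin n → ℕ) → ℕ
total {zero} f = 0
total {suc n} f = f zero + total (f ∘ suc)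

total-mono-≤ : ∀ {n} {f g : Fin n → ℕ} → (∀ i → f i ≤ g i) → total f ≤ total g
total-mono-≤ {zero} f≤g = z≤n
total-mono-≤ {suc n} f≤g = +-mono-≤ (f≤g zero) (total-mono-≤ (f≤g ∘ suc))

total-mono-< : ∀ {n} {f g : Fin n → ℕ} → (∀ i → f i ≤ g i) → ∀ j → f j < g j → total f < total g
total-mono-< f≤g zero fj<gj = +-mono-<-≤ fj<gj (total-mono-≤ (f≤g ∘ suc))
total-mono-< f≤g (suc j) fj<gj = +-mono-≤-< (f≤g zero) (total-mono-< (f≤g ∘ suc) j fj<gj)

module _ {A : Set} {{_ : IsDecEquivalence {A = A} _≡_}} where

  choosePair : ∀ (P : A → Set) {a b p q} → P a → P b → a ≢ b → p ≢ q
             → ∃ λ α → ∃ λ β → P α × P β × α ≢ β × α ≢ p × β ≢ q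
  choosePair P {a} {b} {p} {q} Pa Pb a≢b p≢q with a ≟ p | b ≟ q
  ... | no a≢p | no b≢q = a , b , Pa , Pb , a≢b , a≢p , b≢q
  ... | yes refl | _ = b , a , Pb , Pa , a≢b ∘ sym , a≢b ∘ sym , p≢q
  ... | no _ | yes refl = b , a , Pb , Pa , a≢b ∘ sym , p≢q ∘ sym , a≢b

fresh : ∀ {k} (cs : List (Fin k)) → length cs < k → ∃ λ c → c ∉ₗ cs
fresh {k} cs len<k = ¬∀⟶∃¬ k (_∈ₗ cs) (_∈ₗ? cs) λ all∈ → <⇒≱ len<k (injective⇒≤ (index-injective all∈))
  where
  open import Data.List.Membership.DecPropositional {A = Fin k} _≟_ using () renaming (_∈?_ to _∈ₗ?_)
  index-injective : (all∈ : ∀ c → c ∈ₗ cs) → ∀ {c d} → index (all∈ c) ≡ index (all∈ d) → c ≡ d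
  index-injective all∈ {c} {d} same =
    trans (lookup-index (all∈ c)) (trans (cong (Data.List.lookup cs) same) (sym (lookup-index (all∈ d))))

-- Greedy extension of colourings

module GreedyExtension {E : Set} {{_ : IsDecEquivalence {A = E} _≡_}}
         (_~_ : E → E → Set) (~-sym : ∀ {x y} → x ~ y → y ~ x) (~-irrefl : ∀ {x y} → x ~ y → x ≢ y)
         {k : ℕ} (around : E → List E) where

  ProperOutside : List E → (E → Fin k) → Set
  ProperOutside todo c = ∀ {x y} → x ~ y → x ∉ₗ todo → y ∉ₗ todo → c x ≢ c y

  ProperExtension : List E → (E → Fin k) → Set
  ProperExtension todo c₀ = ∃ λ (c : E → Fin k) → (∀ {x} → x ∉ₗ todo → c x ≡ c₀ x) × (∀ {x y} → x ~ y → c x ≢ c y)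

  greedy : (todo : List E)
         → (∀ {x y} → x ∈ₗ todo → x ~ y → y ∈ₗ around x)
         → (∀ {x} → x ∈ₗ todo → length (around x) < k)
         → (c₀ : E → Fin k) → ProperOutside todo c₀
         → ProperExtension todo c₀
  greedy [] _ _ c₀ proper = c₀ , (λ _ → refl) , λ x~y → proper x~y (λ ()) (λ ())
  greedy (t ∷ todo) listed small c₀ proper = extend (greedy todo (listed ∘ there) (small ∘ there) c₁ proper₁)
    where
    colour : ∃ λ a → a ∉ₗ map c₀ (around t)
    colour = fresh (map c₀ (around t)) (subst (_< k) (sym (length-map c₀ (around t))) (small (here refl)))

    c₁ : E → Fin k
    c₁ = c₀ [ t ↦ proj₁ colour ]

    fresh-vs-old : ∀ {y} → t ~ y → y ≢ t → c₁ t ≢ c₁ y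
    fresh-vs-old t~y y≢t eq = proj₂ colour (subst (_∈ₗ map c₀ (around t))
      (sym (trans (sym ([↦]-updates c₀ t _)) (trans eq ([↦]-minimal c₀ _ y≢t))))
      (∈-map⁺ c₀ (listed (here refl) t~y)))

    proper₁ : ProperOutside todo c₁
    proper₁ {x} {y} x~y x∉ y∉ = by-cases (x ≟ t) (y ≟ t)
      where
      by-cases : Dec (x ≡ t) → Dec (y ≡ t) → c₁ x ≢ c₁ y
      by-cases (yes refl) (yes refl) = contradiction refl (~-irrefl x~y)
      by-cases (yes refl) (no y≢t) = fresh-vs-old x~y y≢t
      by-cases (no x≢t) (yes refl) = fresh-vs-old (~-sym x~y) x≢t ∘ sym
      by-cases (no x≢t) (no y≢t) rewrite [↦]-minimal c₀ (proj₁ colour) x≢t | [↦]-minimal c₀ (proj₁ colour) y≢t =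
        proper x~y (λ { (here x≡t) → x≢t x≡t ; (there x∈) → x∉ x∈ }) (λ { (here y≡t) → y≢t y≡t ; (there y∈) → y∉ y∈ })

    extend : ProperExtension todo c₁ → ProperExtension (t ∷ todo) c₀
    extend (c , agrees , proper-c) =
      c , (λ x∉ → trans (agrees (x∉ ∘ there)) ([↦]-minimal c₀ _ (x∉ ∘ here))) , proper-c

-- List colouring of half-edges

module HalfEdges {n k : ℕ} where

  Half : Set
  Half = Fin n × Fin n

  -- Fin (suc k) rather than Fin k: a problem without half-edges still needs some colouring.
  Colour : Set
  Colour = Fin (suc k)

  owner : Half → Fin n
  owner = proj₁

  record Problem : Set where
    constructor problem
    field
      halves : Fin n → Subset n
      list   : Fin n → Subset (suc k)
      mate   : Half → Maybe Half

  module _ (P : Problem) where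
    open Problem P

    record WellFormed : Set where
      field
        enough-colours : ∀ u → ∣ halves u ∣ ≤ ∣ list u ∣
        mate-half      : ∀ {u x g} → mate (u , x) ≡ just g → x ∈ halves u
        mate-sym       : ∀ {h g} → mate h ≡ just g → mate g ≡ just h
        mate-owner     : ∀ {h g} → mate h ≡ just g → owner h ≢ owner g
        mate-choice    : ∀ {h g} → mate h ≡ just g → 2 ≤ ∣ list (owner h) ∣

    record Colouring (φ : Half → Colour) : Set where
      field
        in-list   : ∀ {u x} → x ∈ halves u → φ (u , x) ∈ list u
        injective : ∀ {u x y} → x ∈ halves u → y ∈ halves u → x ≢ y → φ (u , x) ≢ φ (u , y)
        mate-≢    : ∀ {h g} → mate h ≡ just g → φ h ≢ φ g

  size : Problem → ℕ
  size P = total (∣_∣ ∘ Problem.halves P)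

  detach : Half → (Half → Maybe Half) → Half → Maybe Half
  detach h₀ m h with h ≟ h₀ | m h
  ... | yes _ | _ = nothing
  ... | no _ | nothing = nothing
  ... | no _ | just g with g ≟ h₀
  ...   | yes _ = nothing
  ...   | no _ = just g

  detach⁻ : ∀ {h₀ m h g} → detach h₀ m h ≡ just g → h ≢ h₀ × g ≢ h₀ × m h ≡ just g
  detach⁻ {h₀} {m} {h} eq with h ≟ h₀ | m h
  detach⁻ () | yes _ | _
  detach⁻ () | no _ | nothing
  detach⁻ {h₀} eq | no h≢h₀ | just g with g ≟ h₀
  detach⁻ () | no _ | just _ | yes _
  detach⁻ refl | no h≢h₀ | just g | no g≢h₀ = h≢h₀ , g≢h₀ , refl

  detach⁺ : ∀ {h₀ m h g} → h ≢ h₀ → g ≢ h₀ → m h ≡ just g → detach h₀ m h ≡ just g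
  detach⁺ {h₀} {m} {h} {g} h≢h₀ g≢h₀ mh≡g with h ≟ h₀ | m h
  ... | yes h≡h₀ | _ = contradiction h≡h₀ h≢h₀
  ... | no _ | nothing = case mh≡g of λ ()
  ... | no _ | just g' with g' ≟ h₀
  ...   | yes g'≡h₀ = contradiction (trans (sym (just-injective mh≡g)) g'≡h₀) g≢h₀
  ...   | no _ = mh≡g

  colourHalf : Problem → Half → Colour → Problem
  colourHalf P (u , x) a = problem (halves [ u ↦ halves u - x ]) (list [ u ↦ list u - a ]) (detach (u , x) mate)
    where open Problem P

  module ColourHalf (P : Problem) (wf : WellFormed P) {u x a}
           (x∈ : x ∈ Problem.halves P u) (a∈ : a ∈ Problem.list P u)
           (slack : ∀ {y g} → y ≢ x → Problem.mate P (u , y) ≡ just g → 3 ≤ ∣ Problem.list P u ∣) where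
    open Problem P
    open WellFormed wf

    P′ : Problem
    P′ = colourHalf P (u , x) a

    open Problem P′ using () renaming (halves to halves′; list to list′; mate to mate′)

    halves′⊆ : ∀ {v y} → y ∈ halves′ v → y ∈ halves v
    halves′⊆ {v} {y} = [↦]-elim (λ q → y ∈ q → y ∈ halves v) halves u _ (λ { refl → p─q⊆p _ _ }) (λ _ → id)

    halves′⊇ : ∀ {v y} → y ∈ halves v → (v , y) ≢ (u , x) → y ∈ halves′ v
    halves′⊇ {v} {y} y∈ vy≢ux =
      [↦]-elim (y ∈_) halves u _ (λ { refl → x∈p∧x≢y⇒x∈p-y y∈ (vy≢ux ∘ cong (u ,_)) }) (λ _ → y∈)

    list′⊆ : ∀ {v b} → b ∈ list′ v → b ∈ list v
    list′⊆ {v} {b} = [↦]-elim (λ q → b ∈ q → b ∈ list v) list u _ (λ { refl → p─q⊆p _ _ }) (λ _ → id)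

    list′-≢ : ∀ {b} → b ∈ list′ u → b ≢ a
    list′-≢ {b} b∈ = x∈p-y⇒x≢y (subst (b ∈_) ([↦]-updates list u _) b∈)

    ∣halves′∣<∣halves∣ : ∣ halves′ u ∣ < ∣ halves u ∣
    ∣halves′∣<∣halves∣ = subst (λ q → ∣ q ∣ < ∣ halves u ∣) (sym ([↦]-updates halves u _)) (x∈p⇒∣p-x∣<∣p∣ x∈)

    ∣list∣≤1+∣list′∣ : ∣ list u ∣ ≤ suc ∣ list′ u ∣
    ∣list∣≤1+∣list′∣ = subst (λ q → ∣ list u ∣ ≤ suc ∣ q ∣) (sym ([↦]-updates list u _)) (∣p∣≤1+∣p-x∣ (list u) a)

    mate′⁻ : ∀ {h g} → mate′ h ≡ just g → h ≢ (u , x) × g ≢ (u , x) × mate h ≡ just g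
    mate′⁻ = detach⁻ {u , x} {mate}

    mate′⁺ : ∀ {h g} → h ≢ (u , x) → g ≢ (u , x) → mate h ≡ just g → mate′ h ≡ just g
    mate′⁺ = detach⁺ {u , x} {mate}

    unchanged : ∀ {v} → v ≢ u → halves′ v ≡ halves v × list′ v ≡ list v
    unchanged v≢u = [↦]-minimal halves _ v≢u , [↦]-minimal list _ v≢u

    wellFormed : WellFormed P′
    wellFormed = record
      { enough-colours = enough-colours′
      ; mate-half = λ {v} {y} eq → let vy≢ux , _ , m = mate′⁻ {v , y} eq in halves′⊇ (mate-half m) vy≢ux
      ; mate-sym = λ {h} eq → let h≢ , g≢ , m = mate′⁻ {h} eq in mate′⁺ g≢ h≢ (mate-sym m)
      ; mate-owner = λ {h} eq → mate-owner (proj₂ (proj₂ (mate′⁻ {h} eq)))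
      ; mate-choice = λ {h} → mate-choice′ {h}
      }
      where
      enough-colours′ : ∀ v → ∣ halves′ v ∣ ≤ ∣ list′ v ∣
      enough-colours′ v = by-cases (v ≟ u)
        where
        by-cases : Dec (v ≡ u) → ∣ halves′ v ∣ ≤ ∣ list′ v ∣
        by-cases (yes refl) = ≤-pred (≤-trans ∣halves′∣<∣halves∣ (≤-trans (enough-colours u) ∣list∣≤1+∣list′∣))
        by-cases (no v≢u) = let h≡ , l≡ = unchanged v≢u in
          subst₂ (λ p q → ∣ p ∣ ≤ ∣ q ∣) (sym h≡) (sym l≡) (enough-colours v)
      mate-choice′ : ∀ {h g} → mate′ h ≡ just g → 2 ≤ ∣ list′ (owner h) ∣
      mate-choice′ {v , y} {g} eq = by-cases (v ≟ u)
        where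
        vy≢ux : (v , y) ≢ (u , x)
        vy≢ux = proj₁ (mate′⁻ {v , y} eq)
        m : mate (v , y) ≡ just g
        m = proj₂ (proj₂ (mate′⁻ {v , y} eq))
        by-cases : Dec (v ≡ u) → 2 ≤ ∣ list′ v ∣
        by-cases (yes refl) = ≤-pred (≤-trans (slack (vy≢ux ∘ cong (u ,_)) m) ∣list∣≤1+∣list′∣)
        by-cases (no v≢u) = subst (λ q → 2 ≤ ∣ q ∣) (sym (proj₂ (unchanged v≢u))) (mate-choice m)

    smaller : size P′ < size P
    smaller = total-mono-< (λ v → p⊆q⇒∣p∣≤∣q∣ halves′⊆) u ∣halves′∣<∣halves∣

    lift : ∀ {φ} → Colouring P′ φ → (∀ {g} → mate (u , x) ≡ just g → a ≢ φ g) → Colouring P (φ [ (u , x) ↦ a ])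
    lift {φ′} col′ a-free = record { in-list = in-list ; injective = injective ; mate-≢ = mate-≢ }
      where
      open Colouring col′ renaming (in-list to in-list′; injective to injective′; mate-≢ to mate-≢′)
      φ : Half → Colour
      φ = φ′ [ (u , x) ↦ a ]
      at : φ (u , x) ≡ a
      at = [↦]-updates φ′ (u , x) a
      away : ∀ {h} → h ≢ (u , x) → φ h ≡ φ′ h
      away = [↦]-minimal φ′ a

      in-list : ∀ {v y} → y ∈ halves v → φ (v , y) ∈ list v
      in-list {v} {y} y∈ = by-cases ((v , y) ≟ (u , x))
        where
        by-cases : Dec ((v , y) ≡ (u , x)) → φ (v , y) ∈ list v
        by-cases (yes refl) = subst (_∈ list u) (sym at) a∈
        by-cases (no vy≢ux) = subst (_∈ list v) (sym (away vy≢ux)) (list′⊆ (in-list′ (halves′⊇ y∈ vy≢ux)))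

      fresh-vs-old : ∀ {z} → z ∈ halves u → z ≢ x → φ (u , x) ≢ φ (u , z)
      fresh-vs-old {z} z∈ z≢x eq = list′-≢ (in-list′ (halves′⊇ z∈ uz≢ux)) (trans (sym (away uz≢ux)) (trans (sym eq) at))
        where
        uz≢ux : (u , z) ≢ (u , x)
        uz≢ux = z≢x ∘ cong proj₂

      injective : ∀ {v y z} → y ∈ halves v → z ∈ halves v → y ≢ z → φ (v , y) ≢ φ (v , z)
      injective {v} {y} {z} y∈ z∈ y≢z = by-cases ((v , y) ≟ (u , x)) ((v , z) ≟ (u , x))
        where
        by-cases : Dec ((v , y) ≡ (u , x)) → Dec ((v , z) ≡ (u , x)) → φ (v , y) ≢ φ (v , z)
        by-cases (yes refl) (yes refl) = contradiction refl y≢z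
        by-cases (yes refl) (no _) = fresh-vs-old z∈ (y≢z ∘ sym)
        by-cases (no _) (yes refl) = fresh-vs-old y∈ y≢z ∘ sym
        by-cases (no vy≢ux) (no vz≢ux) eq = injective′ (halves′⊇ y∈ vy≢ux) (halves′⊇ z∈ vz≢ux) y≢z
          (trans (sym (away vy≢ux)) (trans eq (away vz≢ux)))

      mate-≢ : ∀ {h g} → mate h ≡ just g → φ h ≢ φ g
      mate-≢ {h} {g} m = by-cases (h ≟ (u , x)) (g ≟ (u , x))
        where
        by-cases : Dec (h ≡ (u , x)) → Dec (g ≡ (u , x)) → φ h ≢ φ g
        by-cases (yes refl) (yes refl) = contradiction refl (mate-owner m)
        by-cases (yes refl) (no g≢ux) eq = a-free m (trans (sym at) (trans eq (away g≢ux)))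
        by-cases (no h≢ux) (yes refl) eq = a-free (mate-sym m) (trans (sym at) (trans (sym eq) (away h≢ux)))
        by-cases (no h≢ux) (no g≢ux) eq = mate-≢′ (mate′⁺ h≢ux g≢ux m)
          (trans (sym (away h≢ux)) (trans eq (away g≢ux)))


  just? : ∀ {A : Set} (m : Maybe A) → Dec (∃ λ a → m ≡ just a)
  just? nothing = no λ { (_ , ()) }
  just? (just a) = yes (a , refl)

  module _ (P : Problem) where
    open Problem P

    Mated : Half → Set
    Mated h = ∃ λ g → mate h ≡ just g

    Tight : Half → Set
    Tight (u , x) = ∣ list u ∣ ≤ 2 × ∃ λ x₂ → x₂ ≢ x × Mated (u , x₂)

    tight? : ∀ h → Dec (Tight h)
    tight? (u , x) = (∣ list u ∣ ≤? 2) ×-dec any? (λ x₂ → ¬? (x₂ ≟ x) ×-dec just? (mate (u , x₂)))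

    loose⇒slack : ∀ {u x} → ¬ Tight (u , x) → ∀ {y g} → y ≢ x → mate (u , y) ≡ just g → 3 ≤ ∣ list u ∣
    loose⇒slack {u} loose y≢x m with ∣ list u ∣ ≤? 2
    ... | yes ∣list∣≤2 = contradiction (∣list∣≤2 , _ , y≢x , _ , m) loose
    ... | no ∣list∣≰2 = ≰⇒> ∣list∣≰2

  module ColourPair (P : Problem) (wf : WellFormed P) {u x w y} (m : Problem.mate P (u , x) ≡ just (w , y))
           (loose-u : ¬ Tight P (u , x)) (loose-w : ¬ Tight P (w , y))
           {a b} (a∈ : a ∈ Problem.list P u) (b∈ : b ∈ Problem.list P w) (a≢b : a ≢ b) where
    open Problem P
    open WellFormed wf

    m′ : mate (w , y) ≡ just (u , x)
    m′ = mate-sym m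

    w≢u : w ≢ u
    w≢u = mate-owner m ∘ sym

    module C₁ = ColourHalf P wf {u} {x} {a} (mate-half m) a∈ (loose⇒slack P loose-u)

    list₁-at-w : Problem.list C₁.P′ w ≡ list w
    list₁-at-w = proj₂ (C₁.unchanged w≢u)

    module C₂ = ColourHalf C₁.P′ C₁.wellFormed {w} {y} {b}
      (C₁.halves′⊇ (mate-half m′) (w≢u ∘ cong owner))
      (subst (b ∈_) (sym list₁-at-w) b∈)
      (λ {y′} y′≢y m₁ → subst (λ q → 3 ≤ ∣ q ∣) (sym list₁-at-w)
                          (loose⇒slack P loose-w y′≢y (proj₂ (proj₂ (C₁.mate′⁻ {w , y′} m₁)))))

    P′ : Problem
    P′ = C₂.P′

    wellFormed : WellFormed P′
    wellFormed = C₂.wellFormed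

    smaller : size P′ < size P
    smaller = <-trans C₂.smaller C₁.smaller

    lift : ∀ {φ} → Colouring P′ φ → ∃ (Colouring P)
    lift {φ} col = _ , C₁.lift (C₂.lift col w-unmated) a≢φ₁
      where
      w-unmated : ∀ {g} → Problem.mate C₁.P′ (w , y) ≡ just g → b ≢ φ g
      w-unmated {g} m₁ = let _ , g≢ux , m″ = C₁.mate′⁻ {w , y} m₁ in contradiction (just-unique m′ m″) (g≢ux ∘ sym)
      a≢φ₁ : ∀ {g} → mate (u , x) ≡ just g → a ≢ (φ [ (w , y) ↦ b ]) g
      a≢φ₁ m″ a≡ = a≢b (trans a≡ (trans (cong (φ [ (w , y) ↦ b ]) (just-unique m″ m)) ([↦]-updates φ (w , y) b)))

  link : Half → Half → Maybe Half
  link a b with owner a ≟ owner b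
  ... | yes _ = nothing
  ... | no _ = just b

  link⁻ : ∀ {a b g} → link a b ≡ just g → g ≡ b × owner a ≢ owner b
  link⁻ {a} {b} eq with owner a ≟ owner b
  link⁻ () | yes _
  link⁻ refl | no apart = refl , apart

  link⁺ : ∀ {a b} → owner a ≢ owner b → link a b ≡ just b
  link⁺ {a} {b} apart with owner a ≟ owner b
  ... | yes same = contradiction same apart
  ... | no _ = refl

  join : Half → Half → (Half → Maybe Half) → Half → Maybe Half
  join g₁ g₂ m h with h ≟ g₁ | h ≟ g₂
  ... | yes _ | _ = link g₁ g₂
  ... | no _ | yes _ = link g₂ g₁
  ... | no _ | no _ = m h

  data Joined (g₁ g₂ : Half) (m : Half → Maybe Half) : Half → Half → Set where
    forward  : owner g₁ ≢ owner g₂ → Joined g₁ g₂ m g₁ g₂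
    backward : owner g₂ ≢ owner g₁ → Joined g₁ g₂ m g₂ g₁
    kept     : ∀ {h g} → h ≢ g₁ → h ≢ g₂ → m h ≡ just g → Joined g₁ g₂ m h g

  join⁻ : ∀ {g₁ g₂ m h g} → join g₁ g₂ m h ≡ just g → Joined g₁ g₂ m h g
  join⁻ {g₁} {g₂} {m} {h} eq with h ≟ g₁ | h ≟ g₂
  ... | yes refl | _ with link⁻ {g₁} {g₂} eq
  ...   | refl , apart = forward apart
  join⁻ {g₁} {g₂} {m} {h} eq | no _ | yes refl with link⁻ {g₂} {g₁} eq
  ...   | refl , apart = backward apart
  join⁻ eq | no h≢g₁ | no h≢g₂ = kept h≢g₁ h≢g₂ eq

  join-forward : ∀ {g₁ g₂ m} → owner g₁ ≢ owner g₂ → join g₁ g₂ m g₁ ≡ just g₂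
  join-forward {g₁} {g₂} apart with g₁ ≟ g₁
  ... | yes _ = link⁺ apart
  ... | no g₁≢g₁ = contradiction refl g₁≢g₁

  join-backward : ∀ {g₁ g₂ m} → owner g₂ ≢ owner g₁ → join g₁ g₂ m g₂ ≡ just g₁
  join-backward {g₁} {g₂} apart with g₂ ≟ g₁ | g₂ ≟ g₂
  ... | yes refl | _ = contradiction refl apart
  ... | no _ | yes _ = link⁺ apart
  ... | no _ | no g₂≢g₂ = contradiction refl g₂≢g₂

  join-kept : ∀ {g₁ g₂ m h} → h ≢ g₁ → h ≢ g₂ → join g₁ g₂ m h ≡ m h
  join-kept {g₁} {g₂} {m} {h} h≢g₁ h≢g₂ with h ≟ g₁ | h ≟ g₂
  ... | yes h≡g₁ | _ = contradiction h≡g₁ h≢g₁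
  ... | no _ | yes h≡g₂ = contradiction h≡g₂ h≢g₂
  ... | no _ | no _ = refl

  contract : Problem → Fin n → Fin n → Fin n → Half → Half → Problem
  contract P u x₁ x₂ g₁ g₂ = problem (halves [ u ↦ ⊥ ]) list (join g₁ g₂ (detach (u , x₂) (detach (u , x₁) mate)))
    where open Problem P

  -- The contracted owner u has exactly two colours.  Once its mates g₁, g₂ have distinct colours p, q, one of
  -- the two orderings of u's colours avoids p at the half-edge mated to g₁ and q at the one mated to g₂.
  module Contract (P : Problem) (wf : WellFormed P) {u x₁ x₂ g₁ g₂} (x₁≢x₂ : x₁ ≢ x₂)
           (m₁ : Problem.mate P (u , x₁) ≡ just g₁) (m₂ : Problem.mate P (u , x₂) ≡ just g₂)
           (tight : ∣ Problem.list P u ∣ ≤ 2) where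
    open Problem P
    open WellFormed wf

    P′ : Problem
    P′ = contract P u x₁ x₂ g₁ g₂

    open Problem P′ using () renaming (halves to halves′; mate to mate′)

    h₁ h₂ : Half
    h₁ = u , x₁
    h₂ = u , x₂

    only : ∀ {y} → y ∈ halves u → y ≡ x₁ ⊎ y ≡ x₂
    only {y} y∈ with y ≟ x₁ | y ≟ x₂
    ... | yes y≡x₁ | _ = inj₁ y≡x₁
    ... | no _ | yes y≡x₂ = inj₂ y≡x₂
    ... | no y≢x₁ | no y≢x₂ = contradiction
      (≤-trans (three-elements (mate-half m₁) (mate-half m₂) y∈ x₁≢x₂ (y≢x₁ ∘ sym) (y≢x₂ ∘ sym))
               (≤-trans (enough-colours u) tight))
      λ { (s≤s (s≤s ())) }

    back₁ : mate g₁ ≡ just h₁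
    back₁ = mate-sym m₁

    back₂ : mate g₂ ≡ just h₂
    back₂ = mate-sym m₂

    g₁-away : owner g₁ ≢ u
    g₁-away = mate-owner m₁ ∘ sym

    g₂-away : owner g₂ ≢ u
    g₂-away = mate-owner m₂ ∘ sym

    off-u : ∀ {h} → owner h ≢ u → h ≢ h₁ × h ≢ h₂
    off-u h-away = h-away ∘ cong owner , h-away ∘ cong owner

    g₁≢g₂ : g₁ ≢ g₂
    g₁≢g₂ refl = x₁≢x₂ (cong proj₂ (just-unique back₁ back₂))

    mate″⁻ : ∀ {h g} → detach h₂ (detach h₁ mate) h ≡ just g → (h ≢ h₁ × h ≢ h₂) × (g ≢ h₁ × g ≢ h₂) × mate h ≡ just g
    mate″⁻ eq = let h≢h₂ , g≢h₂ , m′ = detach⁻ {h₂} {detach h₁ mate} eq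
                    h≢h₁ , g≢h₁ , m = detach⁻ {h₁} {mate} m′
                in (h≢h₁ , h≢h₂) , (g≢h₁ , g≢h₂) , m

    mate′-kept : ∀ {h g} → h ≢ g₁ → h ≢ g₂ → h ≢ h₁ × h ≢ h₂ → g ≢ h₁ × g ≢ h₂ → mate h ≡ just g → mate′ h ≡ just g
    mate′-kept h≢g₁ h≢g₂ (h≢h₁ , h≢h₂) (g≢h₁ , g≢h₂) m =
      trans (join-kept h≢g₁ h≢g₂) (detach⁺ {h₂} {detach h₁ mate} h≢h₂ g≢h₂ (detach⁺ {h₁} {mate} h≢h₁ g≢h₁ m))

    mate-of-other : ∀ {h g} → h ≢ h₁ × h ≢ h₂ → mate h ≡ just g → g ≢ g₁ × g ≢ g₂
    mate-of-other (h≢h₁ , h≢h₂) m = (λ { refl → h≢h₁ (just-unique (mate-sym m) back₁) })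
                                   , (λ { refl → h≢h₂ (just-unique (mate-sym m) back₂) })

    halves′⊆ : ∀ {v y} → y ∈ halves′ v → y ∈ halves v
    halves′⊆ {v} {y} = [↦]-elim (λ q → y ∈ q → y ∈ halves v) halves u ⊥ (λ _ y∈⊥ → contradiction y∈⊥ ∉⊥) (λ _ → id)

    halves′⊇ : ∀ {v y} → y ∈ halves v → (v , y) ≢ h₁ × (v , y) ≢ h₂ → y ∈ halves′ v
    halves′⊇ {v} {y} y∈ (≢h₁ , ≢h₂) = [↦]-elim (y ∈_) halves u ⊥
      (λ { refl → [ (λ y≡x₁ → contradiction (cong (u ,_) y≡x₁) ≢h₁)
                  , (λ y≡x₂ → contradiction (cong (u ,_) y≡x₂) ≢h₂) ] (only y∈) })
      (λ _ → y∈)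


    wellFormed : WellFormed P′
    wellFormed = record
      { enough-colours = λ v → ≤-trans (p⊆q⇒∣p∣≤∣q∣ halves′⊆) (enough-colours v)
      ; mate-half = λ {v} {y} → mated-half {v , y}
      ; mate-sym = λ {h} → mate-sym′ {h}
      ; mate-owner = λ {h} → mate-owner′ {h}
      ; mate-choice = λ {h} → mate-choice′ {h}
      }
      where
      mated-half : ∀ {h g} → mate′ h ≡ just g → proj₂ h ∈ halves′ (owner h)
      mated-half {h} eq with join⁻ {g₁} {g₂} {_} {h} eq
      ... | forward _ = halves′⊇ (mate-half back₁) (off-u g₁-away)
      ... | backward _ = halves′⊇ (mate-half back₂) (off-u g₂-away)
      ... | kept _ _ m″ = let h-off , _ , m = mate″⁻ {h} m″ in halves′⊇ (mate-half m) h-off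

      mate-sym′ : ∀ {h g} → mate′ h ≡ just g → mate′ g ≡ just h
      mate-sym′ {h} eq with join⁻ {g₁} {g₂} {_} {h} eq
      ... | forward apart = join-backward (apart ∘ sym)
      ... | backward apart = join-forward (apart ∘ sym)
      ... | kept _ _ m″ = let h-off , g-off , m = mate″⁻ {h} m″
                              g≢g₁ , g≢g₂ = mate-of-other h-off m
                          in mate′-kept g≢g₁ g≢g₂ g-off h-off (mate-sym m)

      mate-owner′ : ∀ {h g} → mate′ h ≡ just g → owner h ≢ owner g
      mate-owner′ {h} eq with join⁻ {g₁} {g₂} {_} {h} eq
      ... | forward apart = apart
      ... | backward apart = apart
      ... | kept _ _ m″ = mate-owner (proj₂ (proj₂ (mate″⁻ {h} m″)))

      mate-choice′ : ∀ {h g} → mate′ h ≡ just g → 2 ≤ ∣ list (owner h) ∣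
      mate-choice′ {h} eq with join⁻ {g₁} {g₂} {_} {h} eq
      ... | forward _ = mate-choice back₁
      ... | backward _ = mate-choice back₂
      ... | kept _ _ m″ = mate-choice (proj₂ (proj₂ (mate″⁻ {h} m″)))

    smaller : size P′ < size P
    smaller = total-mono-< (λ v → p⊆q⇒∣p∣≤∣q∣ halves′⊆) u
      (subst (_< ∣ halves u ∣) (sym (trans (cong ∣_∣ ([↦]-updates halves u ⊥)) (∣⊥∣≡0 n)))
             (x∈p⇒0<∣p∣ (mate-half m₁)))

    module Lift {φ′} (col′ : Colouring P′ φ′) where
      open Colouring col′ renaming (in-list to in-list′; injective to injective′; mate-≢ to mate-≢′)

      ends-differ : ∀ {a b} → a ≢ b → proj₂ a ∈ halves′ (owner a) → proj₂ b ∈ halves′ (owner b)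
                  → (owner a ≢ owner b → mate′ a ≡ just b) → φ′ a ≢ φ′ b
      ends-differ {wa , ya} {wb , yb} a≢b a∈ b∈ linked with wa ≟ wb
      ... | yes refl = injective′ a∈ b∈ (a≢b ∘ cong (wa ,_))
      ... | no apart = mate-≢′ (linked apart)

      p≢q : φ′ g₁ ≢ φ′ g₂
      p≢q = ends-differ g₁≢g₂ (halves′⊇ (mate-half back₁) (off-u g₁-away)) (halves′⊇ (mate-half back₂) (off-u g₂-away))
                        join-forward

      Choice : Set
      Choice = ∃ λ α → ∃ λ β → α ∈ list u × β ∈ list u × α ≢ β × α ≢ φ′ g₁ × β ≢ φ′ g₂

      choice : Choice
      choice with 0<∣p∣⇒nonempty (≤-trans (s≤s z≤n) (mate-choice m₁))
      ... | a , a∈ with 2≤∣p∣⇒∃≢ (mate-choice m₁) a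
      ...   | b , b∈ , b≢a = choosePair (_∈ list u) a∈ b∈ (b≢a ∘ sym) p≢q

      recolour : Choice → ∃ (Colouring P)
      recolour (α , β , α∈ , β∈ , α≢β , α≢p , β≢q) =
        φ , record { in-list = in-list ; injective = injective ; mate-≢ = mate-≢ }
        where
        φ : Half → Colour
        φ = (φ′ [ h₁ ↦ α ]) [ h₂ ↦ β ]

        φ-h₁ : φ h₁ ≡ α
        φ-h₁ = trans ([↦]-minimal (φ′ [ h₁ ↦ α ]) {h₂} β {h₁} (x₁≢x₂ ∘ cong proj₂)) ([↦]-updates φ′ h₁ α)

        φ-h₂ : φ h₂ ≡ β
        φ-h₂ = [↦]-updates (φ′ [ h₁ ↦ α ]) h₂ β

        φ-away : ∀ {h} → h ≢ h₁ × h ≢ h₂ → φ h ≡ φ′ h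
        φ-away (h≢h₁ , h≢h₂) = trans ([↦]-minimal (φ′ [ h₁ ↦ α ]) β h≢h₂) ([↦]-minimal φ′ α h≢h₁)

        φ-g₁ : φ g₁ ≡ φ′ g₁
        φ-g₁ = φ-away (off-u g₁-away)

        φ-g₂ : φ g₂ ≡ φ′ g₂
        φ-g₂ = φ-away (off-u g₂-away)

        in-list : ∀ {v y} → y ∈ halves v → φ (v , y) ∈ list v
        in-list {v} {y} y∈ = by-cases (v ≟ u)
          where
          by-cases : Dec (v ≡ u) → φ (v , y) ∈ list v
          by-cases (yes refl) with only y∈
          ... | inj₁ refl = subst (_∈ list u) (sym φ-h₁) α∈
          ... | inj₂ refl = subst (_∈ list u) (sym φ-h₂) β∈
          by-cases (no v≢u) = subst (_∈ list v) (sym (φ-away (off-u v≢u))) (in-list′ (halves′⊇ y∈ (off-u v≢u)))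

        injective : ∀ {v y z} → y ∈ halves v → z ∈ halves v → y ≢ z → φ (v , y) ≢ φ (v , z)
        injective {v} {y} {z} y∈ z∈ y≢z = by-cases (v ≟ u)
          where
          by-cases : Dec (v ≡ u) → φ (v , y) ≢ φ (v , z)
          by-cases (yes refl) with only y∈ | only z∈
          ... | inj₁ refl | inj₁ refl = contradiction refl y≢z
          ... | inj₁ refl | inj₂ refl = λ eq → α≢β (trans (sym φ-h₁) (trans eq φ-h₂))
          ... | inj₂ refl | inj₁ refl = λ eq → α≢β (trans (sym φ-h₁) (trans (sym eq) φ-h₂))
          ... | inj₂ refl | inj₂ refl = contradiction refl y≢z
          by-cases (no v≢u) eq = injective′ (halves′⊇ y∈ (off-u v≢u)) (halves′⊇ z∈ (off-u v≢u)) y≢z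
            (trans (sym (φ-away (off-u v≢u))) (trans eq (φ-away (off-u v≢u))))

        mate-≢ : ∀ {h g} → mate h ≡ just g → φ h ≢ φ g
        mate-≢ {h} {g} m = by-cases (h ≟ h₁) (h ≟ h₂) (g ≟ h₁) (g ≟ h₂)
          where
          by-cases : Dec (h ≡ h₁) → Dec (h ≡ h₂) → Dec (g ≡ h₁) → Dec (g ≡ h₂) → φ h ≢ φ g
          by-cases (yes refl) _ _ _ eq =
            α≢p (trans (sym φ-h₁) (trans eq (trans (cong φ (just-unique m m₁)) φ-g₁)))
          by-cases (no _) (yes refl) _ _ eq =
            β≢q (trans (sym φ-h₂) (trans eq (trans (cong φ (just-unique m m₂)) φ-g₂)))
          by-cases (no _) (no _) (yes refl) _ eq =
            α≢p (trans (sym φ-h₁) (trans (sym eq) (trans (cong φ (just-unique (mate-sym m) m₁)) φ-g₁)))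
          by-cases (no _) (no _) (no _) (yes refl) eq =
            β≢q (trans (sym φ-h₂) (trans (sym eq) (trans (cong φ (just-unique (mate-sym m) m₂)) φ-g₂)))
          by-cases (no h≢h₁) (no h≢h₂) (no g≢h₁) (no g≢h₂) eq =
            let h≢g₁ , h≢g₂ = mate-of-other (g≢h₁ , g≢h₂) (mate-sym m)
            in mate-≢′ (mate′-kept h≢g₁ h≢g₂ (h≢h₁ , h≢h₂) (g≢h₁ , g≢h₂) m)
                       (trans (sym (φ-away (h≢h₁ , h≢h₂))) (trans eq (φ-away (g≢h₁ , g≢h₂))))

    lift : ∀ {φ′} → Colouring P′ φ′ → ∃ (Colouring P)
    lift col′ = Lift.recolour col′ (Lift.choice col′)

  solve : ∀ P → Acc (_<_ on size) P → WellFormed P → ∃ (Colouring P)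
  solve P (acc rec) wf = by-cases (any? λ u → any? λ x → just? (mate (u , x)))
    where
    open Problem P
    open WellFormed wf

    recurse : ∀ {P′} → size P′ < size P → WellFormed P′ → ∃ (Colouring P′)
    recurse smaller wf′ = solve _ (rec smaller) wf′

    contract-at : ∀ {u x g} → mate (u , x) ≡ just g → Tight P (u , x) → ∃ (Colouring P)
    contract-at m (tight , x₂ , x₂≢x , g₂ , m₂) =
      let module C = Contract P wf (x₂≢x ∘ sym) m m₂ tight in C.lift (proj₂ (recurse C.smaller C.wellFormed))

    no-mates : ¬ (∃ λ u → ∃ λ x → Mated P (u , x)) → Dec (∃ λ u → Nonempty (halves u)) → ∃ (Colouring P)
    no-mates unmated (no empty) = (λ _ → zero) , record
      { in-list = λ {u} x∈ → contradiction (u , _ , x∈) empty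
      ; injective = λ {u} x∈ → contradiction (u , _ , x∈) empty
      ; mate-≢ = λ {h} m → contradiction (proj₁ h , proj₂ h , _ , m) unmated
      }
    no-mates unmated (yes (u , x , x∈))
      with a , a∈ ← 0<∣p∣⇒nonempty (≤-trans (x∈p⇒0<∣p∣ x∈) (enough-colours u))
      = _ , C.lift (proj₂ (recurse C.smaller C.wellFormed)) (λ {g} m → contradiction (u , x , g , m) unmated)
      where module C = ColourHalf P wf x∈ a∈ (λ {y} {g} _ m → contradiction (u , y , g , m) unmated)

    colour-both : ∀ {u x w y} → mate (u , x) ≡ just (w , y) → ¬ Tight P (u , x) → ¬ Tight P (w , y) → ∃ (Colouring P)
    colour-both {u} {x} {w} {y} m loose-u loose-w
      with b , b∈ ← 0<∣p∣⇒nonempty (≤-trans (s≤s z≤n) (mate-choice (mate-sym m)))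
      with a , a∈ , a≢b ← 2≤∣p∣⇒∃≢ (mate-choice m) b
      = C.lift (proj₂ (recurse C.smaller C.wellFormed))
      where module C = ColourPair P wf m loose-u loose-w a∈ b∈ a≢b

    by-cases : Dec (∃ λ u → ∃ λ x → Mated P (u , x)) → ∃ (Colouring P)
    by-cases (no unmated) = no-mates unmated (any? λ u → nonempty? (halves u))
    by-cases (yes (u , x , (w , y) , m)) with tight? P (u , x) | tight? P (w , y)
    ... | yes tight-u | _ = contract-at m tight-u
    ... | no _ | yes tight-w = contract-at (mate-sym m) tight-w
    ... | no loose-u | no loose-w = colour-both m loose-u loose-w

-- Total colourings of graphs

-- An edge is stored as the pair of its ends in increasing order.  Pairs that are not edges are adjacent to
-- no element, so it is harmless that they get colours too.
Element : ℕ → Set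
Element n = Fin n ⊎ (Fin n × Fin n)

allElements : ∀ n → List (Element n)
allElements n = map inj₁ (allFin n) ++ map inj₂ (cartesianProduct (allFin n) (allFin n))

∈-allElements : ∀ {n} (x : Element n) → x ∈ₗ allElements n
∈-allElements (inj₁ v) = ∈-++⁺ˡ (∈-map⁺ inj₁ (∈-allFin v))
∈-allElements {n} (inj₂ (a , b)) =
  ∈-++⁺ʳ (map inj₁ (allFin n)) (∈-map⁺ inj₂ (∈-cartesianProduct⁺ (∈-allFin a) (∈-allFin b)))

module _ {n : ℕ} where

  vertex : Fin n → Element n
  vertex = inj₁

  edge : Fin n → Fin n → Element n
  edge u v with u ≤ᶠ? v
  ... | yes _ = inj₂ (u , v)
  ... | no _ = inj₂ (v , u)

  edge-cases : ∀ u v → edge u v ≡ inj₂ (u , v) ⊎ edge u v ≡ inj₂ (v , u)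
  edge-cases u v with u ≤ᶠ? v
  ... | yes _ = inj₁ refl
  ... | no _ = inj₂ refl

  edge-comm : ∀ {u v} → u ≢ v → edge u v ≡ edge v u
  edge-comm {u} {v} u≢v with u ≤ᶠ? v | v ≤ᶠ? u
  ... | yes u≤v | yes v≤u = contradiction (≤ᶠ-antisym u≤v v≤u) u≢v
  ... | yes _ | no _ = refl
  ... | no _ | yes _ = refl
  ... | no u≰v | no v≰u = contradiction (≤-total u v) [ u≰v , v≰u ]

  edge-injective : ∀ {u v w} → edge u v ≡ edge u w → v ≡ w
  edge-injective {u} {v} {w} eq with edge u v | edge-cases u v | edge u w | edge-cases u w
  edge-injective refl | _ | inj₁ refl | _ | inj₁ refl = refl
  edge-injective refl | _ | inj₁ refl | _ | inj₂ refl = refl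
  edge-injective refl | _ | inj₂ refl | _ | inj₁ refl = refl
  edge-injective refl | _ | inj₂ refl | _ | inj₂ refl = refl

  vertex≢edge : ∀ {u v w} → vertex u ≢ edge v w
  vertex≢edge {u} {v} {w} eq with edge v w | edge-cases v w
  vertex≢edge () | _ | inj₁ refl
  vertex≢edge () | _ | inj₂ refl

module _ {n} (G : Graph n) where

  adj-sym : ∀ {u v} → Adj G u v → Adj G v u
  adj-sym {u} {v} u~v = trans (Graph.sym G v u) u~v

  adj⇒≢ : ∀ {u v} → Adj G u v → u ≢ v
  adj⇒≢ {u} u~u refl with trans (sym u~u) (Graph.irrefl G u)
  ... | ()

  adj⇒∈N : ∀ {v w} → Adj G v w → w ∈ N G v
  adj⇒∈N {v} {w} v~w = lookup⇒[]= w (N G v) (trans (lookup∘tabulate (adj G v) w) v~w)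

  ∈N⇒adj : ∀ {v w} → w ∈ N G v → Adj G v w
  ∈N⇒adj {v} {w} w∈N = trans (sym (lookup∘tabulate (adj G v) w)) ([]=⇒lookup w∈N)

  otherNeighbour : Fin n → Fin n → Fin n
  otherNeighbour v w with deg G v ≤? 2 | w ∈? N G v
  ... | yes deg≤2 | yes w∈N = proj₁ (∣p∣≤2⇒pair deg≤2 w∈N)
  ... | _ | _ = w

  otherNeighbour-covers : ∀ {v w z} → deg G v ≤ 2 → Adj G v w → Adj G v z → z ≡ w ⊎ z ≡ otherNeighbour v w
  otherNeighbour-covers {v} {w} deg≤2 v~w v~z with deg G v ≤? 2 | w ∈? N G v
  ... | yes deg≤2 | yes w∈N = proj₂ (∣p∣≤2⇒pair deg≤2 w∈N) (adj⇒∈N v~z)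
  ... | no deg≰2 | _ = contradiction deg≤2 deg≰2
  ... | _ | no w∉N = contradiction (adj⇒∈N v~w) w∉N

  anyNeighbour : Fin n → Fin n
  anyNeighbour v with any? (_∈? N G v)
  ... | yes (w , _) = w
  ... | no _ = v

  anyNeighbour-adj : ∀ {v w} → Adj G v w → Adj G v (anyNeighbour v)
  anyNeighbour-adj {v} {w} v~w with any? (_∈? N G v)
  ... | yes (_ , w'∈N) = ∈N⇒adj w'∈N
  ... | no none = contradiction (w , adj⇒∈N v~w) none

  neighbours-covered : ∀ {v z} → deg G v ≤ 2 → Adj G v z → z ≡ anyNeighbour v ⊎ z ≡ otherNeighbour v (anyNeighbour v)
  neighbours-covered deg≤2 v~z = otherNeighbour-covers deg≤2 (anyNeighbour-adj v~z) v~z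


  data _~_ : Element n → Element n → Set where
    vertex~vertex : ∀ {u v} → Adj G u v → vertex u ~ vertex v
    vertex~edge   : ∀ {u v} → Adj G u v → vertex u ~ edge u v
    edge~vertex   : ∀ {u v} → Adj G u v → edge u v ~ vertex u
    edge~edge     : ∀ {u v w} → Adj G u v → Adj G u w → v ≢ w → edge u v ~ edge u w

  ~-sym : ∀ {x y} → x ~ y → y ~ x
  ~-sym (vertex~vertex u~v) = vertex~vertex (adj-sym u~v)
  ~-sym (vertex~edge u~v) = edge~vertex u~v
  ~-sym (edge~vertex u~v) = vertex~edge u~v
  ~-sym (edge~edge u~v u~w v≢w) = edge~edge u~w u~v (v≢w ∘ sym)

  ~-irrefl : ∀ {x y} → x ~ y → x ≢ y
  ~-irrefl (vertex~vertex u~v) refl = adj⇒≢ u~v refl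
  ~-irrefl (vertex~edge _) = vertex≢edge
  ~-irrefl (edge~vertex _) = vertex≢edge ∘ sym
  ~-irrefl (edge~edge _ _ v≢w) = v≢w ∘ edge-injective

  module _ (S : Subset n) (S-stable : Stable G S)
           (low-degree : ∀ {v} → v ∉ S → deg G v ≤ 2) where

    S-neighbour-∉ : ∀ {u v} → u ∈ S → Adj G u v → v ∉ S
    S-neighbour-∉ {u} {v} u∈S u~v v∈S with trans (sym u~v) (S-stable u v u∈S v∈S)
    ... | ()

    record ProperOnSEdges {C : Set} (φ : Fin n × Fin n → C) : Set where
      field
        edges≢-at-S  : ∀ {u v w} → u ∈ S → Adj G u v → Adj G u w → v ≢ w → φ (u , v) ≢ φ (u , w)
        edges≢-off-S : ∀ {x u w} → u ∈ S → w ∈ S → Adj G x u → Adj G x w → u ≢ w → φ (u , x) ≢ φ (w , x)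

    record ColouringAtS (k : ℕ) : Set where
      constructor colouringAtS
      field
        vertexColour : Fin n → Fin k
        edgeColour   : Fin n × Fin n → Fin k
        vertex≢edge-at-S : ∀ {u x} → u ∈ S → Adj G u x → vertexColour u ≢ edgeColour (u , x)
        edges-proper : ProperOnSEdges edgeColour
      open ProperOnSEdges edges-proper public

    module _ {k} (L : Fin n → Fin n → Subset (suc k))
             (L-uniform : ∀ {u v w} → u ∈ S → Adj G u v → Adj G u w → L u v ≡ L u w)
             (L-large : ∀ {u v} → u ∈ S → Adj G u v → deg G u ⊔ deg G v ≤ ∣ L u v ∣) where

      open HalfEdges {n} {k} using (Problem; problem; WellFormed; Colouring; solve; size)

      Bridged : Fin n → Fin n → Set
      Bridged u x = u ∈ S × Adj G u x × otherNeighbour x u ∈ S × Adj G x (otherNeighbour x u) × otherNeighbour x u ≢ u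

      bridged? : ∀ u x → Dec (Bridged u x)
      bridged? u x = (u ∈? S) ×-dec (adj G u x ≟ true) ×-dec (o ∈? S) ×-dec (adj G x o ≟ true) ×-dec ¬? (o ≟ u)
        where
        o : Fin n
        o = otherNeighbour x u

      bridged-sym : ∀ {u x} → Bridged u x → Bridged (otherNeighbour x u) x × otherNeighbour x (otherNeighbour x u) ≡ u
      bridged-sym {u} {x} (u∈S , u~x , o∈S , x~o , o≢u) =
        (o∈S , adj-sym x~o , subst (_∈ S) (sym o′≡u) u∈S , subst (Adj G x) (sym o′≡u) (adj-sym u~x)
             , λ o′≡o → o≢u (trans (sym o′≡o) o′≡u)) , o′≡u
        where
        o : Fin n
        o = otherNeighbour x u
        o′≡u : otherNeighbour x o ≡ u
        o′≡u with otherNeighbour-covers (low-degree (S-neighbour-∉ u∈S u~x)) x~o (adj-sym u~x)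
        ... | inj₁ u≡o = contradiction (sym u≡o) o≢u
        ... | inj₂ u≡o′ = sym u≡o′

      halves : Fin n → Subset n
      halves u with u ∈? S
      ... | yes _ = N G u
      ... | no _ = ⊥

      colours : Fin n → Subset (suc k)
      colours u = L u (anyNeighbour u)

      mate : Fin n × Fin n → Maybe (Fin n × Fin n)
      mate (u , x) with bridged? u x
      ... | yes _ = just (otherNeighbour x u , x)
      ... | no _ = nothing

      halves⁻ : ∀ {u x} → x ∈ halves u → u ∈ S × Adj G u x
      halves⁻ {u} x∈ with u ∈? S
      ... | yes u∈S = u∈S , ∈N⇒adj x∈
      ... | no _ = contradiction x∈ ∉⊥

      halves⁺ : ∀ {u x} → u ∈ S → Adj G u x → x ∈ halves u
      halves⁺ {u} u∈S u~x with u ∈? S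
      ... | yes _ = adj⇒∈N u~x
      ... | no u∉S = contradiction u∈S u∉S

      mate⁻ : ∀ {u x g} → mate (u , x) ≡ just g → Bridged u x × g ≡ (otherNeighbour x u , x)
      mate⁻ {u} {x} eq with bridged? u x
      mate⁻ refl | yes bridged = bridged , refl
      mate⁻ () | no _

      mate⁺ : ∀ {u x} → Bridged u x → mate (u , x) ≡ just (otherNeighbour x u , x)
      mate⁺ {u} {x} bridged with bridged? u x
      ... | yes _ = refl
      ... | no ¬bridged = contradiction bridged ¬bridged

      colours-at : ∀ {u x} → u ∈ S → Adj G u x → colours u ≡ L u x
      colours-at u∈S u~x = L-uniform u∈S (anyNeighbour-adj u~x) u~x

      problem₀ : Problem
      problem₀ = problem halves colours mate

      wellFormed₀ : WellFormed problem₀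
      wellFormed₀ = record
        { enough-colours = enough-colours
        ; mate-half = λ {u} {x} eq → let (u∈S , u~x , _) , _ = mate⁻ {u} {x} eq in halves⁺ u∈S u~x
        ; mate-sym = λ {h} → mate-sym {h}
        ; mate-owner = λ {h} → mate-owner {h}
        ; mate-choice = λ {h} → mate-choice {h}
        }
        where
        enough-colours : ∀ u → ∣ halves u ∣ ≤ ∣ colours u ∣
        enough-colours u with nonempty? (halves u)
        ... | no empty = subst (_≤ ∣ colours u ∣) (sym (trans (cong ∣_∣ (Empty-unique empty)) (∣⊥∣≡0 n))) z≤n
        ... | yes (x , x∈) = let u∈S , u~x = halves⁻ x∈ in begin
          ∣ halves u ∣          ≤⟨ p⊆q⇒∣p∣≤∣q∣ (adj⇒∈N ∘ proj₂ ∘ halves⁻) ⟩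
          deg G u               ≤⟨ m≤m⊔n _ _ ⟩
          deg G u ⊔ deg G x     ≤⟨ L-large u∈S u~x ⟩
          ∣ L u x ∣             ≡⟨ cong ∣_∣ (colours-at u∈S u~x) ⟨
          ∣ colours u ∣         ∎
          where open ≤-Reasoning

        mate-sym : ∀ {h g} → mate h ≡ just g → mate g ≡ just h
        mate-sym {u , x} eq with mate⁻ {u} {x} eq
        ... | bridged , refl = let bridged′ , o′≡u = bridged-sym bridged in
          trans (mate⁺ bridged′) (cong (λ z → just (z , x)) o′≡u)

        mate-owner : ∀ {h g} → mate h ≡ just g → proj₁ h ≢ proj₁ g
        mate-owner {u , x} eq with mate⁻ {u} {x} eq
        ... | (_ , _ , _ , _ , o≢u) , refl = o≢u ∘ sym

        mate-choice : ∀ {h g} → mate h ≡ just g → 2 ≤ ∣ colours (proj₁ h) ∣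
        mate-choice {u , x} eq with mate⁻ {u} {x} eq
        ... | (u∈S , u~x , _ , x~o , o≢u) , refl = begin
          2                     ≤⟨ two-elements (adj⇒∈N (adj-sym u~x)) (adj⇒∈N x~o) (o≢u ∘ sym) ⟩
          deg G x               ≤⟨ m≤n⊔m _ _ ⟩
          deg G u ⊔ deg G x     ≤⟨ L-large u∈S u~x ⟩
          ∣ L u x ∣             ≡⟨ cong ∣_∣ (colours-at u∈S u~x) ⟨
          ∣ colours u ∣         ∎
          where open ≤-Reasoning

      listEdgeColouring : ∃ λ (φ : Fin n × Fin n → Fin (suc k))
                        → ProperOnSEdges φ × (∀ {u x} → u ∈ S → Adj G u x → φ (u , x) ∈ L u x)
      listEdgeColouring with solve problem₀ (on-wellFounded size <-wellFounded problem₀) wellFormed₀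
      ... | φ , col = φ , record { edges≢-at-S = at-S ; edges≢-off-S = off-S } , in-L
        where
        open Colouring col
        at-S : ∀ {u v w} → u ∈ S → Adj G u v → Adj G u w → v ≢ w → φ (u , v) ≢ φ (u , w)
        at-S u∈S u~v u~w = injective (halves⁺ u∈S u~v) (halves⁺ u∈S u~w)
        off-S : ∀ {x u w} → u ∈ S → w ∈ S → Adj G x u → Adj G x w → u ≢ w → φ (u , x) ≢ φ (w , x)
        off-S {x} {u} {w} u∈S w∈S x~u x~w u≢w with otherNeighbour-covers (low-degree (S-neighbour-∉ u∈S (adj-sym x~u))) x~u x~w
        ... | inj₁ w≡u = contradiction (sym w≡u) u≢w
        ... | inj₂ refl = mate-≢ (mate⁺ (u∈S , adj-sym x~u , w∈S , x~w , u≢w ∘ sym))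
        in-L : ∀ {u x} → u ∈ S → Adj G u x → φ (u , x) ∈ L u x
        in-L u∈S u~x = subst (φ _ ∈_) (colours-at u∈S u~x) (in-list (halves⁺ u∈S u~x))

    Uncoloured : Element n → Set
    Uncoloured (inj₁ v) = v ∉ S
    Uncoloured (inj₂ (a , b)) = a ∉ S × b ∉ S

    uncoloured? : ∀ x → Dec (Uncoloured x)
    uncoloured? (inj₁ v) = ¬? (v ∈? S)
    uncoloured? (inj₂ (a , b)) = ¬? (a ∈? S) ×-dec ¬? (b ∈? S)

    uncoloured-edge⁺ : ∀ {u v} → u ∉ S → v ∉ S → Uncoloured (edge u v)
    uncoloured-edge⁺ {u} {v} u∉S v∉S with edge u v | edge-cases u v
    ... | _ | inj₁ refl = u∉S , v∉S
    ... | _ | inj₂ refl = v∉S , u∉S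

    uncoloured-edge⁻ : ∀ {u v} → Uncoloured (edge u v) → u ∉ S
    uncoloured-edge⁻ {u} {v} unc with edge u v | edge-cases u v
    uncoloured-edge⁻ (u∉S , _) | _ | inj₁ refl = u∉S
    uncoloured-edge⁻ (_ , u∉S) | _ | inj₂ refl = u∉S

    coloured-vertex : ∀ {u} → ¬ Uncoloured (vertex u) → u ∈ S
    coloured-vertex = decidable-stable (_ ∈? S)

    coloured-edge : ∀ {u v} → u ∉ S → ¬ Uncoloured (edge u v) → v ∈ S
    coloured-edge u∉S coloured = decidable-stable (_ ∈? S) (coloured ∘ uncoloured-edge⁺ u∉S)

    around : Element n → List (Element n)
    around (inj₁ v) = vertex a ∷ vertex b ∷ edge v a ∷ edge v b ∷ []
      where
      a b : Fin n
      a = anyNeighbour v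
      b = otherNeighbour v a
    around (inj₂ (a , b)) = vertex a ∷ vertex b ∷ edge a (otherNeighbour a b) ∷ edge b (otherNeighbour b a) ∷ []

    around-length : ∀ x → length (around x) ≡ 4
    around-length (inj₁ _) = refl
    around-length (inj₂ _) = refl

    around-complete : ∀ {x y} → Uncoloured x → x ~ y → y ∈ₗ around x
    around-complete v∉S (vertex~vertex v~w) with neighbours-covered (low-degree v∉S) v~w
    ... | inj₁ refl = here refl
    ... | inj₂ refl = there (here refl)
    around-complete v∉S (vertex~edge v~w) with neighbours-covered (low-degree v∉S) v~w
    ... | inj₁ refl = there (there (here refl))
    ... | inj₂ refl = there (there (there (here refl)))
    around-complete _ (edge~vertex {u} {v} _) with edge u v | edge-cases u v
    ... | _ | inj₁ refl = here refl
    ... | _ | inj₂ refl = there (here refl)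
    around-complete unc (edge~edge {u} {v} {w} u~v u~w v≢w)
      with otherNeighbour-covers (low-degree (uncoloured-edge⁻ unc)) u~v u~w
    ... | inj₁ w≡v = contradiction (sym w≡v) v≢w
    ... | inj₂ refl with edge u v | edge-cases u v
    ...   | _ | inj₁ refl = there (there (here refl))
    ...   | _ | inj₂ refl = there (there (there (here refl)))

    todo : List (Element n)
    todo = filter uncoloured? (allElements n)

    todo-uncoloured : ∀ {x} → x ∈ₗ todo → Uncoloured x
    todo-uncoloured x∈ = proj₂ (∈-filter⁻ uncoloured? {xs = allElements n} x∈)

    todo-coloured : ∀ {x} → x ∉ₗ todo → ¬ Uncoloured x
    todo-coloured {x} x∉ unc = x∉ (∈-filter⁺ uncoloured? (∈-allElements x) unc)

    module _ {k} (κ : ColouringAtS k) where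
      open ColouringAtS κ

      c₀ : Element n → Fin k
      c₀ (inj₁ v) = vertexColour v
      c₀ (inj₂ (a , b)) with a ∈? S
      ... | yes _ = edgeColour (a , b)
      ... | no _ = edgeColour (b , a)

      c₀-edge : ∀ {u v} → u ∈ S → Adj G u v → c₀ (edge u v) ≡ edgeColour (u , v)
      c₀-edge {u} {v} u∈S u~v with edge u v | edge-cases u v
      ... | _ | inj₁ refl with u ∈? S
      ...   | yes _ = refl
      ...   | no u∉S = contradiction u∈S u∉S
      c₀-edge {u} {v} u∈S u~v | _ | inj₂ refl with v ∈? S
      ...   | yes v∈S = contradiction v∈S (S-neighbour-∉ u∈S u~v)
      ...   | no _ = refl

      c₀-edge-flipped : ∀ {u v} → v ∈ S → Adj G u v → c₀ (edge u v) ≡ edgeColour (v , u)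
      c₀-edge-flipped v∈S u~v = trans (cong c₀ (edge-comm (adj⇒≢ u~v))) (c₀-edge v∈S (adj-sym u~v))

      c₀-proper : ∀ {x y} → x ~ y → ¬ Uncoloured x → ¬ Uncoloured y → c₀ x ≢ c₀ y
      c₀-proper (vertex~vertex u~v) u-coloured v-coloured =
        contradiction (coloured-vertex v-coloured) (S-neighbour-∉ (coloured-vertex u-coloured) u~v)
      c₀-proper (vertex~edge u~v) u-coloured _ rewrite c₀-edge (coloured-vertex u-coloured) u~v =
        vertex≢edge-at-S (coloured-vertex u-coloured) u~v
      c₀-proper (edge~vertex u~v) _ u-coloured rewrite c₀-edge (coloured-vertex u-coloured) u~v =
        vertex≢edge-at-S (coloured-vertex u-coloured) u~v ∘ sym
      c₀-proper (edge~edge {u} {v} {w} u~v u~w v≢w) uv-coloured uw-coloured with u ∈? S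
      ... | yes u∈S rewrite c₀-edge u∈S u~v | c₀-edge u∈S u~w = edges≢-at-S u∈S u~v u~w v≢w
      ... | no u∉S rewrite c₀-edge-flipped (coloured-edge u∉S uv-coloured) u~v
                         | c₀-edge-flipped (coloured-edge u∉S uw-coloured) u~w =
        edges≢-off-S (coloured-edge u∉S uv-coloured) (coloured-edge u∉S uw-coloured) u~v u~w v≢w

      extendToTotal : 5 ≤ k → Σ (TotalColouring G (Fin k)) λ π
                    → (∀ {u} → u ∈ S → vc π u ≡ vertexColour u)
                    × (∀ {u v} → u ∈ S → Adj G u v → ec π u v ≡ edgeColour (u , v))
      extendToTotal 5≤k with greedy todo
          (around-complete ∘ todo-uncoloured)
          (λ {x} _ → subst (_< k) (sym (around-length x)) 5≤k)
          c₀ (λ x~y x∉ y∉ → c₀-proper x~y (todo-coloured x∉) (todo-coloured y∉))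
        where open GreedyExtension _~_ ~-sym ~-irrefl {k} around
      ... | c , agrees , proper = π , vertex-agrees , edge-agrees
        where
        π : TotalColouring G (Fin k)
        π = record
          { vc = c ∘ vertex
          ; ec = λ u v → c (edge u v)
          ; ec-sym = λ u v u~v → cong c (edge-comm (adj⇒≢ u~v))
          ; vv = λ u v u~v → proper (vertex~vertex u~v)
          ; ve = λ u v u~v → proper (vertex~edge u~v)
          ; ee = λ u v w u~v u~w v≢w → proper (edge~edge u~v u~w v≢w)
          }
        vertex-agrees : ∀ {u} → u ∈ S → c (vertex u) ≡ vertexColour u
        vertex-agrees u∈S = agrees (λ u∈ → todo-uncoloured u∈ u∈S)
        edge-agrees : ∀ {u v} → u ∈ S → Adj G u v → c (edge u v) ≡ edgeColour (u , v)
        edge-agrees u∈S u~v = trans (agrees (λ uv∈ → uncoloured-edge⁻ (todo-uncoloured uv∈) u∈S)) (c₀-edge u∈S u~v)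

∉S⇒deg≤2 : ∀ {n} {G : Graph n} {S : Subset n} → (∀ v → 3 ≤ deg G v → v ∈ S) → ∀ {v} → v ∉ S → deg G v ≤ 2
∉S⇒deg≤2 high⇒∈S v∉S = ≤-pred (≰⇒> (v∉S ∘ high⇒∈S _))

lemma9 : ∀ {n} (G : Graph n) (Δ : ℕ) → MaxDegree G Δ → 4 ≤ Δ → TwoSparse G
       → (S : Subset n) → Stable G S → (∀ v → 3 ≤ deg G v → v ∈ S)
       → (p : Fin n → Fin (suc Δ))
       → (L : Fin n → Fin n → Subset (suc Δ))
       → (∀ u v w → u ∈ S → Adj G u v → Adj G u w → L u v ≡ L u w)
       → (∀ u v → u ∈ S → Adj G u v → deg G u ⊔ deg G v ≤ ∣ L u v ∣)
       → (∀ u v → u ∈ S → Adj G u v → p u ∉ L u v)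
       → Σ (TotalColouring G (Fin (suc Δ))) λ π
           → (∀ u → u ∈ S → vc π u ≡ p u)
           × (∀ u v → u ∈ S → Adj G u v → ec π u v ∈ L u v)
lemma9 G Δ _ 4≤Δ _ S stable high⇒∈S p L L-uniform L-large p∉L
  with listEdgeColouring G S stable (∉S⇒deg≤2 {G = G} high⇒∈S) L (λ u∈S → L-uniform _ _ _ u∈S) (λ u∈S → L-large _ _ u∈S)
... | φ , φ-proper , φ∈L
  with extendToTotal G S stable (∉S⇒deg≤2 {G = G} high⇒∈S)
         (colouringAtS p φ (λ u∈S u~x p≡φ → p∉L _ _ u∈S u~x (subst (_∈ L _ _) (sym p≡φ) (φ∈L u∈S u~x))) φ-proper)
         (s≤s 4≤Δ)
... | π , vertex-agrees , edge-agrees =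
  π , (λ _ u∈S → vertex-agrees u∈S) , λ u v u∈S u~v → subst (_∈ L u v) (sym (edge-agrees u∈S u~v)) (φ∈L u∈S u~v)
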